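{- Let $G$ and $H$ be connected graphs. If $S$ is a mutual-visibility set of $G \odot H$ and $S \cap V(G)$ contains at least two vertices, then $S \subseteq (S \cap V(G)) \cup \bigcup_{w \in V(G)\setminus S} V(H_w)$. In particular, if $|V(H)| \ge 2$, then $|S| < |V(G)|\,|V(H)|$. Moreover, $S \cap V(G)$ is a mutual-visibility set of $G$.
   Context: All graphs are finite, simple, undirected and connected. For a graph $G$ and $X \subseteq V(G)$, two vertices $u,v$ are $X$-visible if there exists a shortest $(u,v)$-path $P$ in $G$ with $V(P)\cap X \subseteq \{u,v\}$. A set $X\subseteq V(G)$ is a mutual-visibility set of $G$ if every two vertices of $X$ are $X$-visible. The corona $G\odot H$ is obtained from one copy of $G$ and $|V(G)|$ copies of $H$, the copy associated with $v\in V(G)$ being denoted $H_v$, by joining each $v \in V(G)$ to every vertex of $H_v$. -}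

module Defs where

open import Data.Nat using (ℕ; zero; suc; _+_; _*_; _≤_)
open import Data.Fin using (Fin; _↑ˡ_; _↑ʳ_; splitAt; remQuot; combine)
open import Data.Fin.Subset using (Subset; _∈_; _∉_)
open import Data.Vec using (tabulate; lookup)
open import Data.List using (List; []; _∷_)
open import Data.Sum using (_⊎_; inj₁; inj₂)
open import Data.Product using (_×_; Σ; ∃; _,_)
open import Data.Empty using (⊥)
open import Relation.Binary.PropositionalEquality using (_≡_)
open import Relation.Nullary using (¬_)

record Graph (n : ℕ) : Set₁ where
  field
    Adj   : Fin n → Fin n → Set
    sym   : ∀ {u v} → Adj u v → Adj v u
    irrefl : ∀ {u} → ¬ Adj u u
open Graph public

data Walk {n : ℕ} (G : Graph n) : Fin n → Fin n → Set where
  nil  : ∀ {u} → Walk G u u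
  step : ∀ {u w v} → Adj G u w → Walk G w v → Walk G u v

len : ∀ {n} {G : Graph n} {u v} → Walk G u v → ℕ
len nil        = 0
len (step _ p) = suc (len p)

inner : ∀ {n} {G : Graph n} {u v} → Walk G u v → List (Fin n)
inner nil                       = []
inner (step _ nil)              = []
inner (step {w = w} _ (step a p)) = w ∷ inner (step a p)

Connected : ∀ {n} → Graph n → Set
Connected G = ∀ u v → Walk G u v

-- A shortest (u,v)-path: a (u,v)-walk of minimum length (hence a path).
Shortest : ∀ {n} {G : Graph n} {u v} → Walk G u v → Set
Shortest {G = G} {u} {v} p = ∀ (q : Walk G u v) → len p ≤ len q

data _∈L_ {A : Set} (x : A) : List A → Set where
  here  : ∀ {xs} → x ∈L (x ∷ xs)
  there : ∀ {y xs} → x ∈L xs → x ∈L (y ∷ xs)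

Visible : ∀ {n} (G : Graph n) (X : Subset n) → Fin n → Fin n → Set
Visible G X u v =
  Σ (Walk G u v) λ p → Shortest p × (∀ w → w ∈L inner p → w ∉ X)

MutualVisibility : ∀ {n} (G : Graph n) → Subset n → Set
MutualVisibility G X = ∀ u v → u ∈ X → v ∈ X → Visible G X u v

-- Corona G ⊙ H. Vertices: Fin (n + n * m); the first n are V(G),
-- vertex (v ↑ʳ combine ... ) encodes vertex h of the copy H_v.
gv : ∀ {n m} → Fin n → Fin (n + n * m)
gv {n} {m} a = a ↑ˡ (n * m)

hv : ∀ {n m} → Fin n → Fin m → Fin (n + n * m)
hv {n} {m} v h = n ↑ʳ combine v h

data CVert (n m : ℕ) : Set where
  gV : Fin n → CVert n m
  hV : Fin n → Fin m → CVert n m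

decode : ∀ {n m} → Fin (n + n * m) → CVert n m
decode {n} {m} x with splitAt n x
... | inj₁ a = gV a
... | inj₂ y with remQuot m y
...   | (v , h) = hV v h

CAdj : ∀ {n m} → Graph n → Graph m → CVert n m → CVert n m → Set
CAdj G H (gV a)   (gV b)    = Adj G a b
CAdj G H (gV a)   (hV v h)  = a ≡ v
CAdj G H (hV v h) (gV a)    = v ≡ a
CAdj G H (hV v h) (hV w h') = (v ≡ w) × Adj H h h'

CAdj-sym : ∀ {n m} (G : Graph n) (H : Graph m) {x y} → CAdj G H x y → CAdj G H y x
CAdj-sym G H {gV a} {gV b} e = sym G e
CAdj-sym G H {gV a} {hV v h} e = Relation.Binary.PropositionalEquality.sym e
CAdj-sym G H {hV v h} {gV a} e = Relation.Binary.PropositionalEquality.sym e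
CAdj-sym G H {hV v h} {hV w h'} (e , a) = Relation.Binary.PropositionalEquality.sym e , sym H a

CAdj-irrefl : ∀ {n m} (G : Graph n) (H : Graph m) {x} → ¬ CAdj G H x x
CAdj-irrefl G H {gV a} e = irrefl G e
CAdj-irrefl G H {hV v h} (_ , e) = irrefl H e

corona : ∀ {n m} → Graph n → Graph m → Graph (n + n * m)
corona G H = record
  { Adj    = λ x y → CAdj G H (decode x) (decode y)
  ; sym    = λ {x} {y} → CAdj-sym G H {decode x} {decode y}
  ; irrefl = λ {x} → CAdj-irrefl G H {decode x}
  }

restrictG : ∀ {n m} → Subset (n + n * m) → Subset n
restrictG {n} {m} S = tabulate λ a → lookup S (gv {n} {m} a)

{-# OPTIONS --safe #-}
module Submission where

open import Defs hiding (sym)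
open import Data.Nat using (ℕ; suc; _*_; _+_; _≤_; _<_; z≤n; s≤s; >-nonZero)
open import Data.Nat.Properties
  using (≤-reflexive; ≤-trans; <⇒≤; <⇒≱; m<n⇒0<n; m<m*n; +-assoc; +-mono-≤; +-monoʳ-≤; +-monoˡ-<;
         +-commutativeSemigroup; module ≤-Reasoning)
open import Algebra.Properties.CommutativeSemigroup +-commutativeSemigroup using (x∙yz≈y∙xz)
open import Data.Fin using (Fin; zero; suc; _↑ʳ_; splitAt; remQuot; combine)
open import Data.Fin.Properties using (_≟_; splitAt-↑ˡ; splitAt-↑ʳ; splitAt⁻¹-↑ˡ; splitAt⁻¹-↑ʳ; remQuot-combine; combine-remQuot)
open import Data.Fin.Subset using (Subset; _∈_; _∉_; ∣_∣; Empty; inside; outside)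
open import Data.Fin.Subset.Properties using (_∈?_; ∣p∣≤n; ∣⊥∣≡0; Empty-unique; x∈p⇒∣p-x∣<∣p∣)
open import Data.Vec using (Vec; []; _∷_; here; there; _++_; concat; lookup; group)
import Data.Vec as Vec
open import Data.Vec.Properties using ([]=⇒lookup; lookup⇒[]=; lookup-++ˡ; lookup-++ʳ; lookup-concat; lookup∘tabulate)
open import Data.Sum using (_⊎_; inj₁; inj₂)
open import Data.Product using (_×_; Σ; ∃; _,_; proj₁)
open import Data.Empty using (⊥-elim)
open import Function using (_∘_)
open import Relation.Binary.PropositionalEquality using (_≡_; _≢_; refl; sym; trans; cong; subst; subst₂)
open import Relation.Nullary using (¬_; yes; no)

-- A vertex of the copy H_w is joined to the rest of G ⊙ H only through w, so a shortest path
-- from it to a second vertex of S ∩ V(G) has w as an inner vertex: S never contains both w and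
-- a vertex of H_w. Counting copy by copy then gives |S| < |V(G)| |V(H)|. Collapsing every copy
-- H_v onto v maps walks of G ⊙ H to walks of G that are strictly shorter whenever they enter a
-- copy, so a shortest path of G ⊙ H between vertices of G is a shortest path of G, and
-- S-visibility in G ⊙ H gives (S ∩ V(G))-visibility in G.

module _ {k : ℕ} {G : Graph k} where

  ∈inner-step⁻ : ∀ {u w v c} (e : Adj G u w) (p : Walk G w v) →
                 c ∈L inner (step e p) → (c ≡ w × 0 < len p) ⊎ c ∈L inner p
  ∈inner-step⁻ e (step _ p) here      = inj₁ (refl , s≤s z≤n)
  ∈inner-step⁻ e (step _ p) (there c∈) = inj₂ c∈

  ∈inner-step⁺ : ∀ {u w v c} (e : Adj G u w) (p : Walk G w v) →
                 (c ≡ w × 0 < len p) ⊎ c ∈L inner p → c ∈L inner (step e p)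
  ∈inner-step⁺ e (step _ p) (inj₁ (refl , _)) = here
  ∈inner-step⁺ e (step _ p) (inj₂ c∈)         = there c∈

∈-resp-lookup : ∀ {k l} {p : Subset k} {q : Subset l} {x y} → lookup p x ≡ lookup q y → x ∈ p → y ∈ q
∈-resp-lookup {q = q} {y = y} eq x∈p = lookup⇒[]= y q (trans (sym eq) ([]=⇒lookup x∈p))

∣p++q∣≡∣p∣+∣q∣ : ∀ {k l} (p : Subset k) (q : Subset l) → ∣ p ++ q ∣ ≡ ∣ p ∣ + ∣ q ∣
∣p++q∣≡∣p∣+∣q∣ []            q = refl
∣p++q∣≡∣p∣+∣q∣ (inside  ∷ p) q = cong suc (∣p++q∣≡∣p∣+∣q∣ p q)
∣p++q∣≡∣p∣+∣q∣ (outside ∷ p) q = ∣p++q∣≡∣p∣+∣q∣ p q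

∈⇒0<∣p∣ : ∀ {k} {p : Subset k} {x} → x ∈ p → 0 < ∣ p ∣
∈⇒0<∣p∣ x∈p = m<n⇒0<n (x∈p⇒∣p-x∣<∣p∣ x∈p)

∣p∣*m+∣concat∣≤k*m : ∀ {k m} (p : Subset k) (qs : Vec (Subset m) k) →
                     (∀ i → i ∈ p → Empty (lookup qs i)) → ∣ p ∣ * m + ∣ concat qs ∣ ≤ k * m
∣p∣*m+∣concat∣≤k*m []            []       _     = z≤n
∣p∣*m+∣concat∣≤k*m {suc k} {m} (inside ∷ p) (q ∷ qs) empty = begin
  (m + ∣ p ∣ * m) + ∣ q ++ concat qs ∣     ≡⟨ cong (m + ∣ p ∣ * m +_) (∣p++q∣≡∣p∣+∣q∣ q (concat qs)) ⟩
  (m + ∣ p ∣ * m) + (∣ q ∣ + ∣ concat qs ∣) ≡⟨ cong (λ t → m + ∣ p ∣ * m + (t + ∣ concat qs ∣)) ∣q∣≡0 ⟩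
  (m + ∣ p ∣ * m) + ∣ concat qs ∣           ≡⟨ +-assoc m (∣ p ∣ * m) (∣ concat qs ∣) ⟩
  m + (∣ p ∣ * m + ∣ concat qs ∣)           ≤⟨ +-monoʳ-≤ m (∣p∣*m+∣concat∣≤k*m p qs (λ i → empty (suc i) ∘ there)) ⟩
  m + k * m                                 ∎
  where
  open ≤-Reasoning
  ∣q∣≡0 : ∣ q ∣ ≡ 0
  ∣q∣≡0 = trans (cong ∣_∣ (Empty-unique (empty zero here))) (∣⊥∣≡0 m)
∣p∣*m+∣concat∣≤k*m {suc k} {m} (outside ∷ p) (q ∷ qs) empty = begin
  ∣ p ∣ * m + ∣ q ++ concat qs ∣         ≡⟨ cong (∣ p ∣ * m +_) (∣p++q∣≡∣p∣+∣q∣ q (concat qs)) ⟩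
  ∣ p ∣ * m + (∣ q ∣ + ∣ concat qs ∣)     ≡⟨ x∙yz≈y∙xz (∣ p ∣ * m) ∣ q ∣ ∣ concat qs ∣ ⟩
  ∣ q ∣ + (∣ p ∣ * m + ∣ concat qs ∣)     ≤⟨ +-mono-≤ (∣p∣≤n q) (∣p∣*m+∣concat∣≤k*m p qs (λ i → empty (suc i) ∘ there)) ⟩
  m + k * m                              ∎
  where open ≤-Reasoning

module _ {n m : ℕ} where

  decode-gv : (a : Fin n) → decode {n} {m} (gv a) ≡ gV a
  decode-gv a rewrite splitAt-↑ˡ n a (n * m) = refl

  decode-hv : (v : Fin n) (h : Fin m) → decode {n} {m} (hv v h) ≡ hV v h
  decode-hv v h rewrite splitAt-↑ʳ n (n * m) (combine v h) =
    cong (λ (v , h) → hV v h) (remQuot-combine {n} {m} v h)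

  data _liesOver_ : Fin (n + n * m) → Fin n → Set where
    root : ∀ a → gv a liesOver a
    leaf : ∀ a h → hv a h liesOver a

  over : ∀ x → ∃ (x liesOver_)
  over x with splitAt n x in eq
  ... | inj₁ a = a , subst (_liesOver a) (splitAt⁻¹-↑ˡ eq) (root a)
  ... | inj₂ y = let v , h = remQuot {n} m y in
    v , subst (_liesOver v) (trans (cong (n ↑ʳ_) (combine-remQuot {n} m y)) (splitAt⁻¹-↑ʳ eq)) (leaf v h)

  base : CVert n m → Fin n
  base (gV a)   = a
  base (hV a _) = a

  liesOver⇒base : ∀ {x a} → x liesOver a → base (decode x) ≡ a
  liesOver⇒base (root a)   = cong base (decode-gv a)
  liesOver⇒base (leaf a h) = cong base (decode-hv a h)

  liesOver-unique : ∀ {x a b} → x liesOver a → x liesOver b → a ≡ b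
  liesOver-unique x/a x/b = trans (sym (liesOver⇒base x/a)) (liesOver⇒base x/b)

  ∈restrictG⇒gv∈ : ∀ {S c} → c ∈ restrictG {n} {m} S → gv c ∈ S
  ∈restrictG⇒gv∈ {S} {c} = ∈-resp-lookup (lookup∘tabulate (lookup S ∘ gv) c)

  NoRootWithCopy : Subset (n + n * m) → Set
  NoRootWithCopy S = ∀ w h → gv {n} {m} w ∈ S → hv w h ∉ S

  noRootWithCopy⇒⊆roots∪freeCopies : ∀ {S} → NoRootWithCopy S → ∀ x → x ∈ S →
    (Σ (Fin n) λ a → x ≡ gv a) ⊎ (Σ (Fin n) λ w → Σ (Fin m) λ h → x ≡ hv w h × gv {n} {m} w ∉ S)
  noRootWithCopy⇒⊆roots∪freeCopies {S} noCopy x x∈S with over x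
  ... | _ , root a = inj₁ (a , refl)
  ... | _ , leaf w h with gv w ∈? S
  ...   | yes w∈S = ⊥-elim (noCopy w h w∈S x∈S)
  ...   | no  w∉S = inj₂ (w , h , refl , w∉S)

  -- S = roots ++ concat blocks with block i the copy H_i; a root in S, whose block is empty,
  -- is charged the m vertices of that block.
  noRootWithCopy⇒∣S∣<n*m : ∀ {S a} → 2 ≤ m → NoRootWithCopy S → gv a ∈ S → ∣ S ∣ < n * m
  noRootWithCopy⇒∣S∣<n*m {S} {a} 2≤m noCopy a∈S with Vec.splitAt n S
  ... | roots , copies , refl with group n m copies
  ... | blocks , refl = begin-strict
    ∣ roots ++ concat blocks ∣           ≡⟨ ∣p++q∣≡∣p∣+∣q∣ roots (concat blocks) ⟩
    ∣ roots ∣ + ∣ concat blocks ∣         <⟨ +-monoˡ-< ∣ concat blocks ∣ (m<m*n ∣ roots ∣ m ⦃ >-nonZero (∈⇒0<∣p∣ a∈roots) ⦄ 2≤m) ⟩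
    ∣ roots ∣ * m + ∣ concat blocks ∣     ≤⟨ ∣p∣*m+∣concat∣≤k*m roots blocks emptyBlock ⟩
    n * m                                 ∎
    where
    open ≤-Reasoning
    lookup-gv : ∀ i → lookup (roots ++ concat blocks) (gv i) ≡ lookup roots i
    lookup-gv i = lookup-++ˡ roots (concat blocks) i
    lookup-hv : ∀ i j → lookup (roots ++ concat blocks) (hv i j) ≡ lookup (lookup blocks i) j
    lookup-hv i j = trans (lookup-++ʳ roots (concat blocks) (combine i j)) (lookup-concat blocks i j)
    a∈roots : a ∈ roots
    a∈roots = ∈-resp-lookup (lookup-gv a) a∈S
    emptyBlock : ∀ i → i ∈ roots → Empty (lookup blocks i)
    emptyBlock i i∈roots (j , j∈block) =
      noCopy i j (∈-resp-lookup (sym (lookup-gv i)) i∈roots) (∈-resp-lookup (sym (lookup-hv i j)) j∈block)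

module _ {n m : ℕ} {G : Graph n} {H : Graph m} where

  private
    C : Graph (n + n * m)
    C = corona G H

  adj-gv-gv : ∀ {a b} → Adj C (gv a) (gv b) → Adj G a b
  adj-gv-gv {a} {b} = subst₂ (CAdj G H) (decode-gv a) (decode-gv b)

  adj-gv-gv⁻ : ∀ {a b} → Adj G a b → Adj C (gv a) (gv b)
  adj-gv-gv⁻ {a} {b} = subst₂ (CAdj G H) (sym (decode-gv a)) (sym (decode-gv b))

  adj-gv-hv : ∀ {a v h} → Adj C (gv a) (hv v h) → a ≡ v
  adj-gv-hv {a} {v} {h} = subst₂ (CAdj G H) (decode-gv a) (decode-hv v h)

  adj-hv-gv : ∀ {v h a} → Adj C (hv v h) (gv a) → v ≡ a
  adj-hv-gv {v} {h} {a} = subst₂ (CAdj G H) (decode-hv v h) (decode-gv a)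

  adj-hv-hv : ∀ {v h w h′} → Adj C (hv v h) (hv w h′) → v ≡ w
  adj-hv-hv {v} {h} {w} {h′} = proj₁ ∘ subst₂ (CAdj G H) (decode-hv v h) (decode-hv w h′)

  adj-liesOver : ∀ {x y a b} → x liesOver a → y liesOver b → Adj C x y → (Adj G a b × y ≡ gv b) ⊎ a ≡ b
  adj-liesOver (root a)   (root b)   e = inj₁ (adj-gv-gv e , refl)
  adj-liesOver (root a)   (leaf b h) e = inj₂ (adj-gv-hv e)
  adj-liesOver (leaf a h) (root b)   e = inj₂ (adj-hv-gv e)
  adj-liesOver (leaf a h) (leaf b _) e = inj₂ (adj-hv-hv e)

  walk-from-copy-visits-root : ∀ {w : Fin n} {h : Fin m} {y a} (p : Walk C (hv w h) y) → y liesOver a → a ≢ w → gv w ∈L inner p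
  walk-from-copy-visits-root {w} {h} nil y/a a≢w = ⊥-elim (a≢w (liesOver-unique y/a (leaf w h)))
  walk-from-copy-visits-root (step {w = x} e p) y/a a≢w with over {n} {m} x
  ... | _ , root c with adj-hv-gv e
  ...   | refl with p
  ...     | nil      = ⊥-elim (a≢w (liesOver-unique y/a (root c)))
  ...     | step _ _ = here
  walk-from-copy-visits-root (step e p) y/a a≢w | _ , leaf c h′ with adj-hv-hv e
  ... | refl = ∈inner-step⁺ e p (inj₂ (walk-from-copy-visits-root p y/a a≢w))

  root-hides-copy : ∀ {S a w h} → MutualVisibility C S → gv a ∈ S → a ≢ w → gv w ∈ S → hv {n} {m} w h ∉ S
  root-hides-copy {a = a} {w} {h} mv a∈S a≢w w∈S h∈S with mv (hv w h) (gv a) h∈S a∈S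
  ... | p , _ , p-clear = p-clear (gv w) (walk-from-copy-visits-root p (root a) a≢w) w∈S

  mutualVisibility⇒noRootWithCopy : ∀ {S} → MutualVisibility C S →
    (Σ (Fin n) λ a → Σ (Fin n) λ b → a ≢ b × gv {n} {m} a ∈ S × gv {n} {m} b ∈ S) → NoRootWithCopy S
  mutualVisibility⇒noRootWithCopy mv (a , b , a≢b , a∈S , b∈S) w h w∈S with a ≟ w
  ... | yes refl = root-hides-copy mv b∈S (a≢b ∘ sym) w∈S
  ... | no  a≢w  = root-hides-copy mv a∈S a≢w w∈S

  Shadow : ∀ {x y} → Walk C x y → Fin n → Fin n → Set
  Shadow p a b = Σ (Walk G a b) λ q →
    len q < len p ⊎ (len q ≡ len p × (∀ c → c ∈L inner q → gv {n} {m} c ∈L inner p))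

  shadow-len≤ : ∀ {x y a b} {p : Walk C x y} → (s : Shadow p a b) → len (proj₁ s) ≤ len p
  shadow-len≤ (_ , inj₁ q<p)       = <⇒≤ q<p
  shadow-len≤ (_ , inj₂ (q≡p , _)) = ≤-reflexive q≡p

  -- Steps inside a copy of H collapse to a single vertex of G, so the walk only gets shorter;
  -- if it does not, every step was an edge of G between roots.
  project : ∀ {x y a b} (p : Walk C x y) → x liesOver a → y liesOver b → Shadow p a b
  project nil x/a x/b with liesOver-unique x/a x/b
  ... | refl = nil , inj₂ (refl , λ _ ())
  project (step {w = x′} e p) x/a y/b with over {n} {m} x′
  ... | c , x′/c with adj-liesOver x/a x′/c e | project p x′/c y/b
  ...   | inj₂ refl        | s                     = proj₁ s , inj₁ (s≤s (shadow-len≤ s))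
  ...   | inj₁ (adj , refl) | q , inj₁ q<p          = step adj q , inj₁ (s≤s q<p)
  ...   | inj₁ (adj , refl) | q , inj₂ (q≡p , q⊆p) = step adj q , inj₂ (cong suc q≡p , step-q⊆step-p)
    where
    step-q⊆step-p : ∀ d → d ∈L inner (step adj q) → gv d ∈L inner (step e p)
    step-q⊆step-p d d∈ with ∈inner-step⁻ adj q d∈
    ... | inj₁ (refl , 0<q) = ∈inner-step⁺ e p (inj₁ (refl , subst (0 <_) q≡p 0<q))
    ... | inj₂ d∈q          = ∈inner-step⁺ e p (inj₂ (q⊆p d d∈q))

  lift : ∀ {a b} → Walk G a b → Walk C (gv a) (gv b)
  lift nil        = nil
  lift (step e q) = step (adj-gv-gv⁻ e) (lift q)

  len-lift : ∀ {a b} (q : Walk G a b) → len (lift q) ≡ len q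
  len-lift nil        = refl
  len-lift (step e q) = cong suc (len-lift q)

  shortest⇒≤len-in-G : ∀ {a b} {p : Walk C (gv a) (gv b)} → Shortest p → (q : Walk G a b) → len p ≤ len q
  shortest⇒≤len-in-G p-shortest q = ≤-trans (p-shortest (lift q)) (≤-reflexive (len-lift q))

  restrictG-mutualVisibility : ∀ {S} → MutualVisibility C S → MutualVisibility G (restrictG {n} {m} S)
  restrictG-mutualVisibility {S} mv a b a∈ b∈ with mv (gv a) (gv b) (∈restrictG⇒gv∈ a∈) (∈restrictG⇒gv∈ b∈)
  ... | p , p-shortest , p-clear with project p (root a) (root b)
  ...   | q , inj₁ q<p = ⊥-elim (<⇒≱ q<p (shortest⇒≤len-in-G p-shortest q))
  ...   | q , inj₂ (q≡p , q⊆p) =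
    q , (λ r → subst (_≤ len r) (sym q≡p) (shortest⇒≤len-in-G p-shortest r))
      , (λ c c∈q c∈R → p-clear (gv c) (q⊆p c c∈q) (∈restrictG⇒gv∈ c∈R))

mainTheorem7 : ∀ {n m} (G : Graph n) (H : Graph m) → Connected G → Connected H →
    (S : Subset (n + n * m)) → MutualVisibility (corona G H) S →
    (Σ (Fin n) λ a → Σ (Fin n) λ b → ¬ a ≡ b × gv {n} {m} a ∈ S × gv {n} {m} b ∈ S) →
    (∀ x → x ∈ S →
        (Σ (Fin n) λ a → x ≡ gv {n} {m} a)
        ⊎ (Σ (Fin n) λ w → Σ (Fin m) λ h → x ≡ hv w h × gv {n} {m} w ∉ S))
    × (2 ≤ m → ∣ S ∣ < n * m)
    × MutualVisibility G (restrictG {n} {m} S)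
mainTheorem7 G H _ _ S mv roots@(_ , _ , _ , a∈S , _) =
    noRootWithCopy⇒⊆roots∪freeCopies noCopy
  , (λ 2≤m → noRootWithCopy⇒∣S∣<n*m 2≤m noCopy a∈S)
  , restrictG-mutualVisibility mv
  where
  noCopy : NoRootWithCopy S
  noCopy = mutualVisibility⇒noRootWithCopy mv roots
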